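{- Let $(G,\sigma)$ be a signed canonical unicyclic graph whose underlying graph has girth $g$ and which is not a cycle. Then $r(G,\sigma)=g$ if and only if both of the following hold: (a) $g$ is even; (b) $G\in F_1$, or $G\in F_2$ and between any two consecutive (along the cycle) star center vertices on the cycle of $G$ there is an odd number of cycle vertices.
   Context: A signed graph $(G,\sigma)$ is a simple graph with $\sigma:E(G)\to\{+,-\}$; its adjacency matrix has $(i,j)$-entry $\sigma(v_iv_j)$ for edges and $0$ otherwise, and $r(G,\sigma)$ is its rank. The girth is the length of a shortest cycle. $S_q$ denotes the star $K_{1,q-1}$ ($q\geq 2$) with its center vertex. A canonical unicyclic graph is a graph obtained from a cycle $C_n$ by identifying some (possibly none, possibly all) vertices of the cycle with the centers of stars, i.e. by attaching one or more pendant vertices to each of some vertices of the cycle; the cycle vertices with pendant neighbors are called star center vertices. $F_1$ is the set of graphs obtained by identifying exactly one vertex of $C_n$ with the center of a star $S_q$; $F_2$ is the set of graphs obtained by identifying $i$ vertices $u_1,\dots,u_i$ ($2\leq i\leq n$) of $C_n$ with the centers of stars $S_{q_1},\dots,S_{q_i}$ respectively. -}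

module Defs where

open import Data.Nat using (ℕ; zero; suc; _+_; _<_; _≤_; _∸_)
open import Data.Nat.DivMod using (_%_; m%n<n)
open import Data.Nat.Divisibility using (_∣_)
open import Data.Fin using (Fin; toℕ; fromℕ<; _≟_)
open import Data.Rational using (ℚ; 0ℚ; 1ℚ; -_) renaming (_+_ to _+ℚ_; _*_ to _*ℚ_)
open import Data.Sum using (_⊎_; inj₁; inj₂)
open import Data.Product using (Σ; ∃; _×_; _,_)
open import Relation.Nullary using (¬_; yes; no)
open import Relation.Binary.PropositionalEquality using (_≡_; _≢_)

data Sign : Set where
  plus minus : Sign

sgn : Sign → ℚ
sgn plus  = 1ℚ
sgn minus = - 1ℚ

shift : {n : ℕ} → Fin n → ℕ → Fin n
shift {suc m} i d = fromℕ< (m%n<n (toℕ i + d) (suc m))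

next : {n : ℕ} → Fin n → Fin n
next i = shift i 1

-- Canonical unicyclic graph with cycle C_n (vertices Fin n, edges {i, i+1 mod n})
-- and p i pendant vertices attached to cycle vertex i.
Vertex : (n : ℕ) → (p : Fin n → ℕ) → Set
Vertex n p = Fin n ⊎ Σ (Fin n) (λ i → Fin (p i))

-- Signature: sc i is the sign of cycle edge {i, next i};
-- sp i j is the sign of the pendant edge {i, (i , j)}.
cycleEntry : {n : ℕ} → (Fin n → Sign) → Fin n → Fin n → ℚ
cycleEntry sc a b with b ≟ next a | a ≟ next b
... | yes _ | _     = sgn (sc a)
... | no _  | yes _ = sgn (sc b)
... | no _  | no _  = 0ℚ

pendEntry : {n : ℕ} {p : Fin n → ℕ} → ((i : Fin n) → Fin (p i) → Sign) →
            Fin n → (i : Fin n) → Fin (p i) → ℚ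
pendEntry sp a i j with a ≟ i
... | yes _ = sgn (sp i j)
... | no _  = 0ℚ

adj : (n : ℕ) (p : Fin n → ℕ) (sc : Fin n → Sign)
      (sp : (i : Fin n) → Fin (p i) → Sign) → Vertex n p → Vertex n p → ℚ
adj n p sc sp (inj₁ a)       (inj₁ b)       = cycleEntry sc a b
adj n p sc sp (inj₁ a)       (inj₂ (i , j)) = pendEntry {p = p} sp a i j
adj n p sc sp (inj₂ (i , j)) (inj₁ a)       = pendEntry {p = p} sp a i j
adj n p sc sp (inj₂ _)       (inj₂ _)       = 0ℚ

∑ : (k : ℕ) → (Fin k → ℚ) → ℚ
∑ zero    f = 0ℚ
∑ (suc k) f = f Fin.zero +ℚ ∑ k (λ j → f (Fin.suc j))
  where import Data.Fin as Fin

RowsIndependent : {V : Set} → (V → V → ℚ) → {k : ℕ} → (Fin k → V) → Set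
RowsIndependent {V} M {k} s =
  (c : Fin k → ℚ) → ((v : V) → ∑ k (λ j → c j *ℚ M (s j) v) ≡ 0ℚ) → (j : Fin k) → c j ≡ 0ℚ

HasRank : {V : Set} → (V → V → ℚ) → ℕ → Set
HasRank {V} M r =
  (Σ (Fin r → V) (λ s → RowsIndependent M s)) ×
  ((s : Fin (suc r) → V) → ¬ RowsIndependent M s)

IsCenter : {n : ℕ} → (Fin n → ℕ) → Fin n → Set
IsCenter p i = 0 < p i

InF₁ : (n : ℕ) → (Fin n → ℕ) → Set
InF₁ n p = Σ (Fin n) (λ i → IsCenter p i × ((j : Fin n) → IsCenter p j → j ≡ i))

InF₂ : (n : ℕ) → (Fin n → ℕ) → Set
InF₂ n p = Σ (Fin n) (λ i → Σ (Fin n) (λ j → i ≢ j × IsCenter p i × IsCenter p j))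

ConsecutiveOdd : (n : ℕ) → (Fin n → ℕ) → Set
ConsecutiveOdd n p =
  (i : Fin n) (d : ℕ) → 1 ≤ d → d < n →
  IsCenter p i → IsCenter p (shift i d) →
  ((e : ℕ) → 1 ≤ e → e < d → ¬ IsCenter p (shift i e)) →
  ¬ (2 ∣ (d ∸ 1))

-- Let n be the length of the cycle and b a star center.  If n is odd, or some star center has
-- the parity opposite to b, then the row of a pendant vertex at b together with the n cycle rows
-- are independent: in a vanishing combination each pendant column kills the coefficient of its
-- center, and each cycle column y ≠ b ties the coefficients of prev y and next y together, so
-- zeros travel in steps of two along the path obtained by cutting the cycle at b and reach both
-- parity classes.  Hence the rank exceeds n.
-- Otherwise n is even and all centers have the parity of b.  A vertex of the other parity carries
-- no pendant and its neighbours have b's parity, so every row is a combination of the cycle rows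
-- and the unit vectors of the n/2 vertices of b's parity: the rank is at most n, and an explicit
-- choice of n rows is independent.
-- For even n, "all centers have one parity" says exactly that G ∈ F₁, or G ∈ F₂ with an odd
-- number of cycle vertices between consecutive centers.
module Submission where

open import Defs
open import Data.Nat using (ℕ; _≤_)
open import Data.Nat.Divisibility using (_∣_)
open import Data.Fin using (Fin)
open import Data.Sum using (_⊎_)
open import Data.Product using (Σ; _×_)
open import Function.Bundles using (_⇔_)

open import Algebra.Bundles using (CommutativeRing)
open import Data.Empty using (⊥-elim)
open import Data.Fin as Fin using (zero; suc; toℕ; fromℕ<; punchIn; punchOut)
import Data.Fin.Properties as Finₚ
open import Data.Nat using (zero; suc; s≤s)
open import Data.Nat.Divisibility using (_∣?_)
import Data.Nat.Properties as ℕₚ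
open import Data.Product using (∃; _,_; proj₁; proj₂)
open import Data.Sum using (inj₁; inj₂)
open import Function using (_∘_)
open import Function.Bundles using (mk⇔)
open import Relation.Nullary using (¬_; Dec; yes; no; ¬?)
open import Relation.Nullary.Decidable using (_×-dec_; decidable-stable)
open import Relation.Binary.PropositionalEquality

module NatParity where
  open import Data.Nat
  open import Data.Nat.Divisibility using (divides)
  open ℕₚ
  open ≡-Reasoning

  [1+m]%2≢m%2 : ∀ m → suc m % 2 ≢ m % 2
  [1+m]%2≢m%2 zero    ()
  [1+m]%2≢m%2 (suc m) eq = [1+m]%2≢m%2 m (sym eq)

  2∣m+m : ∀ m → 2 ∣ m + m
  2∣m+m m = divides m (trans (cong (m +_) (sym (+-identityʳ m))) (*-comm 2 m))

  2∣⇒≡m+m : ∀ {n} → 2 ∣ n → ∃ λ m → n ≡ m + m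
  2∣⇒≡m+m (divides q n≡q*2) = q , trans n≡q*2 (trans (*-comm q 2) (cong (q +_) (+-identityʳ q)))

  even⊎odd : ∀ n → ∃ λ m → n ≡ m + m ⊎ n ≡ suc (m + m)
  even⊎odd zero = 0 , inj₁ refl
  even⊎odd (suc n) with even⊎odd n
  ... | m , inj₁ n≡m+m   = m , inj₂ (cong suc n≡m+m)
  ... | m , inj₂ n≡1+m+m = suc m , inj₁ (cong suc (trans n≡1+m+m (sym (+-suc m m))))

  ¬2∣⇒2∣1+ : ∀ {n} → ¬ 2 ∣ n → 2 ∣ suc n
  ¬2∣⇒2∣1+ {n} ¬2∣n with even⊎odd n
  ... | m , inj₁ refl = ⊥-elim (¬2∣n (2∣m+m m))
  ... | m , inj₂ refl = subst (2 ∣_) (cong suc (+-suc m m)) (2∣m+m (suc m))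

  m+m≤n+n⇒m≤n : ∀ {m n} → m + m ≤ n + n → m ≤ n
  m+m≤n+n⇒m≤n m+m≤n+n = ≮⇒≥ λ n<m → <⇒≱ (+-mono-< n<m n<m) m+m≤n+n

  r+[1+j+1+j]≡2+r+[j+j] : ∀ r j → r + (suc j + suc j) ≡ 2 + (r + (j + j))
  r+[1+j+1+j]≡2+r+[j+j] r j = begin
    r + suc (j + suc j)    ≡⟨ +-suc r _ ⟩
    suc (r + (j + suc j))  ≡⟨ cong (λ z → suc (r + z)) (+-suc j j) ⟩
    suc (r + suc (j + j))  ≡⟨ cong suc (+-suc r _) ⟩
    2 + (r + (j + j))      ∎

  module _ {Z : ℕ → Set} {N : ℕ} where

    ascend : (∀ k → 2 + k ≤ N → Z k → Z (2 + k)) →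
             ∀ r {i j} → i ≤ j → r + (j + j) ≤ N → Z (r + (i + i)) → Z (r + (j + j))
    ascend up r {i} i≤j bound zi = go (≤⇒≤′ i≤j) bound
      where
      go : ∀ {j} → i ≤′ j → r + (j + j) ≤ N → Z (r + (j + j))
      go ≤′-refl _ = zi
      go (≤′-step {j} i≤′j) bound =
        subst Z (sym (r+[1+j+1+j]≡2+r+[j+j] r j)) (up _ bound′ (go i≤′j (m+n≤o⇒n≤o 2 bound′)))
        where bound′ = subst (_≤ N) (r+[1+j+1+j]≡2+r+[j+j] r j) bound

    descend : (∀ k → 2 + k ≤ N → Z (2 + k) → Z k) →
              ∀ r {i j} → i ≤ j → r + (j + j) ≤ N → Z (r + (j + j)) → Z (r + (i + i))
    descend down r {i} i≤j = go (≤⇒≤′ i≤j)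
      where
      go : ∀ {j} → i ≤′ j → r + (j + j) ≤ N → Z (r + (j + j)) → Z (r + (i + i))
      go ≤′-refl _ zi = zi
      go (≤′-step {j} i≤′j) bound zj =
        go i≤′j (m+n≤o⇒n≤o 2 bound′) (down _ bound′ (subst Z (r+[1+j+1+j]≡2+r+[j+j] r j) zj))
        where bound′ = subst (_≤ N) (r+[1+j+1+j]≡2+r+[j+j] r j) bound

    between : (∀ k → 2 + k ≤ N → Z k → Z (2 + k)) → (∀ k → 2 + k ≤ N → Z (2 + k) → Z k) →
              ∀ r {i j} → r + (i + i) ≤ N → r + (j + j) ≤ N → Z (r + (i + i)) → Z (r + (j + j))
    between up down r {i} {j} i-bound j-bound with ≤-total i j
    ... | inj₁ i≤j = ascend up r i≤j j-bound
    ... | inj₂ j≤i = descend down r j≤i i-bound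

open NatParity

module LinearAlgebra where
  open import Data.Nat using (_<_)
  open import Data.Rational using (ℚ; 0ℚ; 1ℚ; _+_; _*_; -_; 1/_; ≢-nonZero)
  import Data.Rational.Properties as ℚₚ
  open import Data.Rational.Solver using (module +-*-Solver)
  open import Data.Vec.Functional using (insertAt; removeAt)
  open import Data.Vec.Functional.Properties using (insertAt-lookup; insertAt-punchIn)
  open import Algebra.Properties.Semiring.Sum (CommutativeRing.semiring ℚₚ.+-*-commutativeRing) public
    using (sum; sum-cong-≗; sum-remove; sum-replicate-zero; ∑-distrib-+; ∑-comm; *-distribˡ-sum; *-distribʳ-sum)
  open +-*-Solver
  open ≡-Reasoning

  ∑≡sum : ∀ k (f : Fin k → ℚ) → ∑ k f ≡ sum f
  ∑≡sum zero    f = refl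
  ∑≡sum (suc k) f = cong (f zero +_) (∑≡sum k (f ∘ suc))

  x*a≡0⇒x≡0 : ∀ {x a} → a ≢ 0ℚ → x * a ≡ 0ℚ → x ≡ 0ℚ
  x*a≡0⇒x≡0 {x} {a} a≢0 xa≡0 = begin
    x               ≡⟨ ℚₚ.*-identityʳ x ⟨
    x * 1ℚ          ≡⟨ cong (x *_) (ℚₚ.*-inverseʳ a) ⟨
    x * (a * 1/ a)  ≡⟨ ℚₚ.*-assoc x a (1/ a) ⟨
    x * a * 1/ a    ≡⟨ cong (_* 1/ a) xa≡0 ⟩
    0ℚ * 1/ a       ≡⟨ ℚₚ.*-zeroˡ (1/ a) ⟩
    0ℚ              ∎
    where instance _ = ≢-nonZero a≢0

  *-≢0 : ∀ {a b} → a ≢ 0ℚ → b ≢ 0ℚ → a * b ≢ 0ℚ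
  *-≢0 {a} {b} a≢0 b≢0 ab≡0 = b≢0 (x*a≡0⇒x≡0 a≢0 (trans (ℚₚ.*-comm b a) ab≡0))

  x≡0⇒x*a≡0 : ∀ {x} a → x ≡ 0ℚ → x * a ≡ 0ℚ
  x≡0⇒x*a≡0 a refl = ℚₚ.*-zeroˡ a

  x≡0⇒a*x≡0 : ∀ a {x} → x ≡ 0ℚ → a * x ≡ 0ℚ
  x≡0⇒a*x≡0 a refl = ℚₚ.*-zeroʳ a

  x*a+z≡0⇒x≡0 : ∀ {x a z} → a ≢ 0ℚ → z ≡ 0ℚ → x * a + z ≡ 0ℚ → x ≡ 0ℚ
  x*a+z≡0⇒x≡0 a≢0 refl eq = x*a≡0⇒x≡0 a≢0 (trans (sym (ℚₚ.+-identityʳ _)) eq)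

  z+x*a≡0⇒x≡0 : ∀ {x a z} → a ≢ 0ℚ → z ≡ 0ℚ → z + x * a ≡ 0ℚ → x ≡ 0ℚ
  z+x*a≡0⇒x≡0 a≢0 refl eq = x*a≡0⇒x≡0 a≢0 (trans (sym (ℚₚ.+-identityˡ _)) eq)

  z+w≡0⇒w≡0 : ∀ {z w} → z ≡ 0ℚ → z + w ≡ 0ℚ → w ≡ 0ℚ
  z+w≡0⇒w≡0 refl eq = trans (sym (ℚₚ.+-identityˡ _)) eq

  δ : ∀ {k} → Fin k → Fin k → ℚ
  δ i j with j Fin.≟ i
  ... | yes _ = 1ℚ
  ... | no  _ = 0ℚ

  δ-diag : ∀ {k} (i : Fin k) → δ i i ≡ 1ℚ
  δ-diag i with i Fin.≟ i
  ... | yes _   = refl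
  ... | no  i≢i = ⊥-elim (i≢i refl)

  δ-offDiag : ∀ {k} {i j : Fin k} → j ≢ i → δ i j ≡ 0ℚ
  δ-offDiag {i = i} {j} j≢i with j Fin.≟ i
  ... | yes j≡i = ⊥-elim (j≢i j≡i)
  ... | no  _   = refl

  sum-zero : ∀ {k} {f : Fin k → ℚ} → (∀ i → f i ≡ 0ℚ) → sum f ≡ 0ℚ
  sum-zero {k} f≡0 = trans (sum-cong-≗ f≡0) (sum-replicate-zero k)

  sum-single : ∀ {k} (f : Fin k → ℚ) (i : Fin k) → (∀ j → j ≢ i → f j ≡ 0ℚ) → sum f ≡ f i
  sum-single {suc k} f i f≡0 = begin
    sum f                     ≡⟨ sum-remove {i = i} f ⟩
    f i + sum (removeAt f i)  ≡⟨ cong (f i +_) (sum-zero λ j → f≡0 _ (Finₚ.punchInᵢ≢i i j)) ⟩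
    f i + 0ℚ                  ≡⟨ ℚₚ.+-identityʳ (f i) ⟩
    f i                       ∎

  sum-pair : ∀ {k} (f : Fin k → ℚ) {i j : Fin k} → i ≢ j →
             (∀ l → l ≢ i → l ≢ j → f l ≡ 0ℚ) → sum f ≡ f i + f j
  sum-pair {suc k} f {i} {j} i≢j f≡0 = begin
    sum f                               ≡⟨ sum-remove {i = i} f ⟩
    f i + sum (removeAt f i)            ≡⟨ cong (f i +_) (sum-single (removeAt f i) (punchOut i≢j) others) ⟩
    f i + f (punchIn i (punchOut i≢j))  ≡⟨ cong (λ l → f i + f l) (Finₚ.punchIn-punchOut i≢j) ⟩
    f i + f j                           ∎
    where
    others : ∀ l → l ≢ punchOut i≢j → f (punchIn i l) ≡ 0ℚ
    others l l≢ = f≡0 _ (Finₚ.punchInᵢ≢i i l)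
      (λ eq → l≢ (trans (sym (Finₚ.punchOut-punchIn i)) (Finₚ.punchOut-cong i eq)))

  sum-δ : ∀ {k} (i : Fin k) (f : Fin k → ℚ) → sum (λ j → δ i j * f j) ≡ f i
  sum-δ i f = begin
    sum (λ j → δ i j * f j)  ≡⟨ sum-single _ i (λ j j≢i → x≡0⇒x*a≡0 (f j) (δ-offDiag j≢i)) ⟩
    δ i i * f i              ≡⟨ cong (_* f i) (δ-diag i) ⟩
    1ℚ * f i                 ≡⟨ ℚₚ.*-identityˡ (f i) ⟩
    f i                      ∎

  sum-scaled-δ : ∀ {k} a (i : Fin k) (f : Fin k → ℚ) → sum (λ j → a * δ i j * f j) ≡ a * f i
  sum-scaled-δ a i f = begin
    sum (λ j → a * δ i j * f j)    ≡⟨ sum-cong-≗ (λ j → ℚₚ.*-assoc a (δ i j) (f j)) ⟩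
    sum (λ j → a * (δ i j * f j))  ≡⟨ *-distribˡ-sum a (λ j → δ i j * f j) ⟨
    a * sum (λ j → δ i j * f j)    ≡⟨ cong (a *_) (sum-δ i f) ⟩
    a * f i                        ∎

  sum-δ₂ : ∀ {k} a b (i j : Fin k) (f : Fin k → ℚ) →
           sum (λ t → (a * δ i t + b * δ j t) * f t) ≡ a * f i + b * f j
  sum-δ₂ a b i j f = begin
    sum (λ t → (a * δ i t + b * δ j t) * f t)
      ≡⟨ sum-cong-≗ (λ t → ℚₚ.*-distribʳ-+ (f t) (a * δ i t) (b * δ j t)) ⟩
    sum (λ t → a * δ i t * f t + b * δ j t * f t)
      ≡⟨ ∑-distrib-+ (λ t → a * δ i t * f t) (λ t → b * δ j t * f t) ⟩
    sum (λ t → a * δ i t * f t) + sum (λ t → b * δ j t * f t)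
      ≡⟨ cong₂ _+_ (sum-scaled-δ a i f) (sum-scaled-δ b j f) ⟩
    a * f i + b * f j
      ∎

  Dependent : ∀ {m k} → (Fin m → Fin k → ℚ) → Set
  Dependent {m} A =
    Σ (Fin m → ℚ) λ c → (∃ λ i → c i ≢ 0ℚ) × (∀ t → sum (λ i → c i * A i t) ≡ 0ℚ)

  dependent-zero-column : ∀ {m k} (A : Fin m → Fin (suc k) → ℚ) → (∀ i → A i zero ≡ 0ℚ) →
                          Dependent (λ i t → A i (suc t)) → Dependent A
  dependent-zero-column A A₀≡0 (c , c≢0 , c-kills) = c , c≢0 , λ where
    zero    → sum-zero λ i → x≡0⇒a*x≡0 (c i) (A₀≡0 i)
    (suc t) → c-kills t

  eliminate : ∀ {m k} → (Fin (suc m) → Fin (suc k) → ℚ) → Fin (suc m) → Fin m → Fin k → ℚ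
  eliminate A j i t = A j zero * A (punchIn j i) (suc t) + - (A (punchIn j i) zero * A j (suc t))

  dependent-eliminate : ∀ {m k} (A : Fin (suc m) → Fin (suc k) → ℚ) (j : Fin (suc m)) →
                        A j zero ≢ 0ℚ → Dependent (eliminate A j) → Dependent A
  dependent-eliminate {m} {k} A j a≢0 (c′ , (i , c′ᵢ≢0) , c′-kills) = c , (punchIn j i , cᵢ≢0) , c-kills
    where
    a = A j zero
    S : Fin (suc k) → ℚ
    S t = sum (λ i → c′ i * A (punchIn j i) t)
    c : Fin (suc m) → ℚ
    c = insertAt (λ i → a * c′ i) j (- S zero)
    cᵢ≢0 : c (punchIn j i) ≢ 0ℚ
    cᵢ≢0 = subst (_≢ 0ℚ) (sym (insertAt-punchIn _ j _ i)) (*-≢0 a≢0 c′ᵢ≢0)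
    split : ∀ t → sum (λ x → c x * A x t) ≡ - S zero * A j t + a * S t
    split t = begin
      sum (λ x → c x * A x t)
        ≡⟨ sum-remove {i = j} (λ x → c x * A x t) ⟩
      c j * A j t + sum (λ i → c (punchIn j i) * A (punchIn j i) t)
        ≡⟨ cong₂ _+_ (cong (_* A j t) (insertAt-lookup _ j _))
                     (sum-cong-≗ λ i → trans (cong (_* A (punchIn j i) t) (insertAt-punchIn _ j _ i))
                                             (ℚₚ.*-assoc a (c′ i) _)) ⟩
      - S zero * A j t + sum (λ i → a * (c′ i * A (punchIn j i) t))
        ≡⟨ cong (- S zero * A j t +_) (*-distribˡ-sum a (λ i → c′ i * A (punchIn j i) t)) ⟨
      - S zero * A j t + a * S t
        ∎
    expand : ∀ t → sum (λ i → c′ i * eliminate A j i t) ≡ a * S (suc t) + - A j (suc t) * S zero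
    expand t = begin
      sum (λ i → c′ i * (a * X i + - (Y i * z)))
        ≡⟨ sum-cong-≗ (λ i → solve 5 (λ c a x y z → c :* (a :* x :+ :- (y :* z))
                                                    := a :* (c :* x) :+ :- z :* (c :* y))
                                     refl (c′ i) a (X i) (Y i) z) ⟩
      sum (λ i → a * (c′ i * X i) + - z * (c′ i * Y i))
        ≡⟨ ∑-distrib-+ (λ i → a * (c′ i * X i)) (λ i → - z * (c′ i * Y i)) ⟩
      sum (λ i → a * (c′ i * X i)) + sum (λ i → - z * (c′ i * Y i))
        ≡⟨ cong₂ _+_ (*-distribˡ-sum a (λ i → c′ i * X i)) (*-distribˡ-sum (- z) (λ i → c′ i * Y i)) ⟨
      a * S (suc t) + - z * S zero
        ∎
      where
      X Y : Fin m → ℚ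
      X i = A (punchIn j i) (suc t)
      Y i = A (punchIn j i) zero
      z = A j (suc t)
    c-kills : ∀ t → sum (λ x → c x * A x t) ≡ 0ℚ
    c-kills zero    = trans (split zero) (solve 2 (λ s a → :- s :* a :+ a :* s := con 0ℚ) refl (S zero) a)
    c-kills (suc t) = begin
      sum (λ x → c x * A x (suc t))             ≡⟨ split (suc t) ⟩
      - S zero * A j (suc t) + a * S (suc t)    ≡⟨ solve 3 (λ s z r → :- s :* z :+ r := r :+ :- z :* s)
                                                           refl (S zero) (A j (suc t)) (a * S (suc t)) ⟩
      a * S (suc t) + - A j (suc t) * S zero    ≡⟨ expand t ⟨
      sum (λ i → c′ i * eliminate A j i t)      ≡⟨ c′-kills t ⟩
      0ℚ                                        ∎

  k<m⇒dependent : ∀ {m k} → k < m → (A : Fin m → Fin k → ℚ) → Dependent A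
  k<m⇒dependent {suc m} {zero}  _          A = (λ _ → 1ℚ) , (zero , ℚₚ.1≢0) , λ ()
  k<m⇒dependent {suc m} {suc k} (s≤s k<m) A with Finₚ.any? (λ i → ¬? (A i zero ℚₚ.≟ 0ℚ))
  ... | yes (j , a≢0) = dependent-eliminate A j a≢0 (k<m⇒dependent k<m (eliminate A j))
  ... | no  no-pivot  = dependent-zero-column A
          (λ i → decidable-stable (A i zero ℚₚ.≟ 0ℚ) (λ Aᵢ₀≢0 → no-pivot (i , Aᵢ₀≢0)))
          (k<m⇒dependent (ℕₚ.m≤n⇒m≤1+n k<m) (λ i t → A i (suc t)))

  span⇒¬independent : ∀ {V : Set} {k} (M : V → V → ℚ) (w : Fin k → V → ℚ) (a : V → Fin k → ℚ) →
                      (∀ v u → M v u ≡ sum (λ t → a v t * w t u)) →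
                      (s : Fin (suc k) → V) → ¬ RowsIndependent M s
  span⇒¬independent {k = k} M w a M≡aw s independent with k<m⇒dependent ℕₚ.≤-refl (λ j t → a (s j) t)
  ... | c , (i , cᵢ≢0) , c-kills = cᵢ≢0 (independent c combination≡0 i)
    where
    combination≡0 : ∀ u → ∑ (suc k) (λ j → c j * M (s j) u) ≡ 0ℚ
    combination≡0 u = begin
      ∑ (suc k) (λ j → c j * M (s j) u)
        ≡⟨ ∑≡sum (suc k) (λ j → c j * M (s j) u) ⟩
      sum (λ j → c j * M (s j) u)
        ≡⟨ sum-cong-≗ (λ j → cong (c j *_) (M≡aw (s j) u)) ⟩
      sum (λ j → c j * sum (λ t → a (s j) t * w t u))
        ≡⟨ sum-cong-≗ (λ j → *-distribˡ-sum (c j) (λ t → a (s j) t * w t u)) ⟩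
      sum (λ j → sum (λ t → c j * (a (s j) t * w t u)))
        ≡⟨ ∑-comm (λ j t → c j * (a (s j) t * w t u)) ⟩
      sum (λ t → sum (λ j → c j * (a (s j) t * w t u)))
        ≡⟨ sum-cong-≗ (λ t → trans (*-distribʳ-sum (w t u) (λ j → c j * a (s j) t))
                                   (sum-cong-≗ λ j → ℚₚ.*-assoc (c j) (a (s j) t) (w t u))) ⟨
      sum (λ t → sum (λ j → c j * a (s j) t) * w t u)
        ≡⟨ sum-zero (λ t → x≡0⇒x*a≡0 (w t u) (c-kills t)) ⟩
      0ℚ
        ∎

open LinearAlgebra

module Cycle (m : ℕ) where
  open import Data.Nat
  open import Data.Nat.DivMod
  open import Data.Nat.Divisibility using (_∣0)
  open import Data.Nat.Solver using (module +-*-Solver)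
  open +-*-Solver using (solve; _:+_; _:=_; con)
  open ℕₚ
  open ≡-Reasoning

  n : ℕ
  n = suc m

  prev : Fin n → Fin n
  prev x = shift x m

  toℕ-shift : ∀ (x : Fin n) d → toℕ (shift x d) ≡ (toℕ x + d) % n
  toℕ-shift x d = Finₚ.toℕ-fromℕ< _

  [a%n+k]%n≡[a+k]%n : ∀ a k → (a % n + k) % n ≡ (a + k) % n
  [a%n+k]%n≡[a+k]%n a k = begin
    (a % n + k) % n          ≡⟨ %-distribˡ-+ (a % n) k n ⟩
    (a % n % n + k % n) % n  ≡⟨ cong (λ z → (z + k % n) % n) (m%n%n≡m%n a n) ⟩
    (a % n + k % n) % n      ≡⟨ %-distribˡ-+ a k n ⟨
    (a + k) % n              ∎

  shift-shift : ∀ (x : Fin n) d e → shift (shift x d) e ≡ shift x (d + e)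
  shift-shift x d e = Finₚ.toℕ-injective (begin
    toℕ (shift (shift x d) e)  ≡⟨ toℕ-shift (shift x d) e ⟩
    (toℕ (shift x d) + e) % n  ≡⟨ cong (λ z → (z + e) % n) (toℕ-shift x d) ⟩
    ((toℕ x + d) % n + e) % n  ≡⟨ [a%n+k]%n≡[a+k]%n (toℕ x + d) e ⟩
    (toℕ x + d + e) % n        ≡⟨ cong (_% n) (+-assoc (toℕ x) d e) ⟩
    (toℕ x + (d + e)) % n      ≡⟨ toℕ-shift x (d + e) ⟨
    toℕ (shift x (d + e))      ∎)

  shift-zero : ∀ (x : Fin n) → shift x 0 ≡ x
  shift-zero x = Finₚ.toℕ-injective (begin
    toℕ (shift x 0)  ≡⟨ toℕ-shift x 0 ⟩
    (toℕ x + 0) % n  ≡⟨ cong (_% n) (+-identityʳ (toℕ x)) ⟩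
    toℕ x % n        ≡⟨ m<n⇒m%n≡m (Finₚ.toℕ<n x) ⟩
    toℕ x            ∎)

  shift-n : ∀ (x : Fin n) → shift x n ≡ x
  shift-n x = Finₚ.toℕ-injective (begin
    toℕ (shift x n)  ≡⟨ toℕ-shift x n ⟩
    (toℕ x + n) % n  ≡⟨ [m+n]%n≡m%n (toℕ x) n ⟩
    toℕ x % n        ≡⟨ m<n⇒m%n≡m (Finₚ.toℕ<n x) ⟩
    toℕ x            ∎)

  shift-+n : ∀ (x : Fin n) d → shift x (d + n) ≡ shift x d
  shift-+n x d = trans (sym (shift-shift x d n)) (shift-n (shift x d))

  shift≢ : ∀ (x : Fin n) {k} → 0 < k → k < n → shift x k ≢ x
  shift≢ x {k} 0<k k<n shift≡x = k≢q*n q (+-cancelˡ-≡ a k (q * n) (begin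
    a + k                ≡⟨ m≡m%n+[m/n]*n (a + k) n ⟩
    (a + k) % n + q * n  ≡⟨ cong (_+ q * n) (trans (sym (toℕ-shift x k)) (cong toℕ shift≡x)) ⟩
    a + q * n            ∎))
    where
    a = toℕ x
    q = (a + k) / n
    k≢q*n : ∀ q → k ≢ q * n
    k≢q*n zero    k≡0 = <⇒≢ 0<k (sym k≡0)
    k≢q*n (suc q) k≡n+q*n = <⇒≱ k<n (subst (n ≤_) (sym k≡n+q*n) (m≤m+n n (q * n)))

  next-shift : ∀ (x : Fin n) k → next (shift x k) ≡ shift x (suc k)
  next-shift x k = trans (shift-shift x k 1) (cong (shift x) (+-comm k 1))

  prev-shift : ∀ (x : Fin n) k → prev (shift x (suc k)) ≡ shift x k
  prev-shift x k = trans (shift-shift x (suc k) m) (trans (cong (shift x) (sym (+-suc k m))) (shift-+n x k))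

  next-prev : ∀ x → next (prev x) ≡ x
  next-prev x = trans (next-shift x m) (shift-n x)

  prev-next : ∀ x → prev (next x) ≡ x
  prev-next x = trans (prev-shift x 0) (shift-zero x)

  next≢prev : 2 ≤ m → ∀ x → next x ≢ prev x
  next≢prev (s≤s (s≤s {n = k} _)) x next≡prev =
    shift≢ (next x) (s≤s z≤n) (s≤s (n≤1+n (suc k))) (trans (shift-shift x 1 (suc k)) (sym next≡prev))

  prev≢next : 2 ≤ m → ∀ x → prev x ≢ next x
  prev≢next 2≤m x = next≢prev 2≤m x ∘ sym

  offset : Fin n → Fin n → ℕ
  offset b x = (toℕ x + (n ∸ toℕ b)) % n

  offset<n : ∀ b x → offset b x < n
  offset<n b x = m%n<n (toℕ x + (n ∸ toℕ b)) n

  shift-offset : ∀ b x → shift b (offset b x) ≡ x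
  shift-offset b x = Finₚ.toℕ-injective (begin
    toℕ (shift b (offset b x))          ≡⟨ toℕ-shift b (offset b x) ⟩
    (toℕ b + offset b x) % n            ≡⟨ cong (_% n) (+-comm (toℕ b) (offset b x)) ⟩
    (offset b x + toℕ b) % n            ≡⟨ [a%n+k]%n≡[a+k]%n (toℕ x + (n ∸ toℕ b)) (toℕ b) ⟩
    (toℕ x + (n ∸ toℕ b) + toℕ b) % n   ≡⟨ cong (_% n) (+-assoc (toℕ x) (n ∸ toℕ b) (toℕ b)) ⟩
    (toℕ x + (n ∸ toℕ b + toℕ b)) % n   ≡⟨ cong (λ z → (toℕ x + z) % n) (m∸n+n≡m (Finₚ.toℕ≤n b)) ⟩
    (toℕ x + n) % n                     ≡⟨ [m+n]%n≡m%n (toℕ x) n ⟩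
    toℕ x % n                           ≡⟨ m<n⇒m%n≡m (Finₚ.toℕ<n x) ⟩
    toℕ x                               ∎)

  -- The two-step moves avoid b, so they stay on the path b, b + 1, …, b + n = b, whose two parity
  -- classes contain b and shift b (1 + 2q).
  cover-path : ∀ (P : Fin n → Set) b →
               (∀ y → y ≢ b → P (prev y) → P (next y)) → (∀ y → y ≢ b → P (next y) → P (prev y)) →
               P b → ∀ q → suc (q + q) ≤ n → P (shift b (suc (q + q))) → ∀ x → P x
  cover-path P b forward backward Pb q q-bound Pq x = subst P (shift-offset b x) (reach (offset b x) (offset<n b x))
    where
    Z : ℕ → Set
    Z k = P (shift b k)
    up : ∀ k → 2 + k ≤ n → Z k → Z (2 + k)
    up k 2+k≤n Zk = subst P (next-shift b (suc k))
      (forward (shift b (suc k)) (shift≢ b (s≤s z≤n) 2+k≤n) (subst P (sym (prev-shift b k)) Zk))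
    down : ∀ k → 2 + k ≤ n → Z (2 + k) → Z k
    down k 2+k≤n Z2+k = subst P (prev-shift b k)
      (backward (shift b (suc k)) (shift≢ b (s≤s z≤n) 2+k≤n) (subst P (sym (next-shift b (suc k))) Z2+k))
    reach : ∀ o → o < n → Z o
    reach o o<n with even⊎odd o
    ... | s , inj₁ refl = between up down 0 {0} {s} z≤n (<⇒≤ o<n) (subst P (sym (shift-zero b)) Pb)
    ... | s , inj₂ refl = between up down 1 {q} {s} q-bound (<⇒≤ o<n) Pq

  SameParity : Fin n → Fin n → Set
  SameParity x y = toℕ x % 2 ≡ toℕ y % 2

  sameParity? : ∀ x y → Dec (SameParity x y)
  sameParity? x y = toℕ x % 2 ≟ toℕ y % 2

  module _ (2∣n : 2 ∣ n) where

    parity-shift : ∀ x d → toℕ (shift x d) % 2 ≡ (toℕ x + d) % 2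
    parity-shift x d = trans (cong (_% 2) (toℕ-shift x d)) (m∣n⇒o%n%m≡o%m 2 n (toℕ x + d) 2∣n)

    shift-even : ∀ x {d} → 2 ∣ d → SameParity (shift x d) x
    shift-even x {d} 2∣d = trans (parity-shift x d) (%-remove-+ʳ (toℕ x) 2∣d)

    shift-odd : ∀ x {d} → 2 ∣ d → ¬ SameParity (shift x (suc d)) x
    shift-odd x {d} 2∣d same = [1+m]%2≢m%2 (toℕ x + d) (begin
      suc (toℕ x + d) % 2        ≡⟨ cong (_% 2) (+-suc (toℕ x) d) ⟨
      (toℕ x + suc d) % 2        ≡⟨ parity-shift x (suc d) ⟨
      toℕ (shift x (suc d)) % 2  ≡⟨ same ⟩
      toℕ x % 2                  ≡⟨ %-remove-+ʳ (toℕ x) 2∣d ⟨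
      (toℕ x + d) % 2            ∎)

    prev-flips : ∀ x → ¬ SameParity (prev x) x
    prev-flips x same = shift-odd (prev x) (2 ∣0)
      (subst (λ z → SameParity z (prev x)) (sym (next-prev x)) (sym same))

    prev²-sameParity : ∀ x → SameParity (prev (prev x)) x
    prev²-sameParity x = subst (λ z → SameParity z x) (sym (shift-shift x m m)) (shift-even x (2∣m+m m))

    m-odd : ∃ λ t → m ≡ suc (t + t)
    m-odd with 2∣⇒≡m+m 2∣n
    ... | suc t , 1+m≡1+t+1+t = t , trans (suc-injective 1+m≡1+t+1+t) (+-suc t t)

    -- b and prev³ b represent the two parity classes of the even cycle.
    cover-descent : ∀ (P : Fin n → Set) b → (∀ y → P (next y) → P (prev y)) →
                    P b → P (prev (prev (prev b))) → ∀ x → P x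
    cover-descent P b backward Pb Pprev³ x = subst P (shift-offset b x) (reach (offset b x) (offset<n b x))
      where
      t = proj₁ m-odd
      m≡1+t+t = proj₂ m-odd
      j = suc (t + t + t)
      Z : ℕ → Set
      Z k = P (shift b k)
      down : ∀ r {i k} → i ≤ k → Z (r + (k + k)) → Z (r + (i + i))
      down r i≤k = descend {Z = Z} (λ k _ Z2+k → subst P (prev-shift b k)
                     (backward (shift b (suc k)) (subst P (sym (next-shift b (suc k))) Z2+k))) r i≤k ≤-refl
      n≡1+t+1+t : n ≡ suc t + suc t
      n≡1+t+1+t = cong suc (trans m≡1+t+t (sym (+-suc t t)))
      prev³≡ : prev (prev (prev b)) ≡ shift b (suc (j + j))
      prev³≡ = begin
        shift (shift (shift b m) m) m  ≡⟨ cong prev (shift-shift b m m) ⟩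
        shift (shift b (m + m)) m      ≡⟨ shift-shift b (m + m) m ⟩
        shift b (m + m + m)            ≡⟨ cong (λ z → shift b (z + z + z)) m≡1+t+t ⟩
        shift b (suc (t + t) + suc (t + t) + suc (t + t))
          ≡⟨ cong (shift b) (solve 1 (λ t → (con 1 :+ (t :+ t)) :+ (con 1 :+ (t :+ t)) :+ (con 1 :+ (t :+ t))
                                          := con 1 :+ ((con 1 :+ (t :+ t :+ t)) :+ (con 1 :+ (t :+ t :+ t)))) refl t) ⟩
        shift b (suc (j + j))          ∎
      reach : ∀ o → o < n → Z o
      reach o o<n with even⊎odd o
      ... | s , inj₁ refl = down 0 {s} {suc t} (m+m≤n+n⇒m≤n (subst (s + s ≤_) n≡1+t+1+t (<⇒≤ o<n)))
                              (subst P (sym (trans (cong (shift b) (sym n≡1+t+1+t)) (shift-n b))) Pb)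
      ... | s , inj₂ refl = down 1 {s} {j} (≤-trans s≤t t≤j) (subst P prev³≡ Pprev³)
        where
        s≤t : s ≤ t
        s≤t = m+m≤n+n⇒m≤n (≤-pred (≤-pred (subst (suc (suc (s + s)) ≤_) (cong suc m≡1+t+t) o<n)))
        t≤j : t ≤ j
        t≤j = m≤n⇒m≤1+n (≤-trans (m≤m+n t t) (m≤m+n (t + t) t))

module Centers (m : ℕ) (p : Fin (suc m) → ℕ) where
  open import Data.Nat
  open import Data.Nat.Divisibility using (_∣0; ∣m+n∣m⇒∣n)
  open import Data.Nat.Induction using (<-rec)
  open ℕₚ
  open Cycle m

  OddCenter : Fin n → Set
  OddCenter b = ∃ λ q → suc (q + q) ≤ n × IsCenter p (shift b (suc (q + q)))

  SameParityCenters : Fin n → Set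
  SameParityCenters b = ∀ u → IsCenter p u → SameParity u b

  oddCenter-if-n-odd : ¬ 2 ∣ n → ∀ b → IsCenter p b → OddCenter b
  oddCenter-if-n-odd ¬2∣n b b-center with even⊎odd n
  ... | h , inj₁ n≡h+h   = ⊥-elim (¬2∣n (subst (2 ∣_) (sym n≡h+h) (2∣m+m h)))
  ... | h , inj₂ n≡1+h+h = h , ≤-reflexive (sym n≡1+h+h) ,
        subst (IsCenter p) (sym (trans (cong (shift b) (sym n≡1+h+h)) (shift-n b))) b-center

  oddCenter-if-parity-differs : 2 ∣ n → ∀ b {w} → IsCenter p w → ¬ SameParity w b → OddCenter b
  oddCenter-if-parity-differs 2∣n b {w} w-center w≁b with even⊎odd (offset b w)
  ... | s , inj₁ o≡s+s = ⊥-elim (w≁b (subst (λ z → SameParity z b) (shift-offset b w)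
                           (subst (λ o → SameParity (shift b o) b) (sym o≡s+s) (shift-even 2∣n b (2∣m+m s)))))
  ... | s , inj₂ o≡1+s+s = s , <⇒≤ (subst (_< n) o≡1+s+s (offset<n b w)) ,
        subst (IsCenter p) (trans (sym (shift-offset b w)) (cong (shift b) o≡1+s+s)) w-center

  sameParity-or-witness : ∀ b → SameParityCenters b ⊎ ∃ λ w → IsCenter p w × ¬ SameParity w b
  sameParity-or-witness b with Finₚ.any? (λ w → (0 <? p w) ×-dec ¬? (sameParity? w b))
  ... | yes (w , w-center , w≁b) = inj₂ (w , w-center , w≁b)
  ... | no  none = inj₁ λ u u-center → decidable-stable (sameParity? u b) λ u≁b → none (u , u-center , u≁b)

  sameParity⇒F : 2 ∣ n → ∀ b → IsCenter p b → SameParityCenters b →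
                 InF₁ n p ⊎ (InF₂ n p × ConsecutiveOdd n p)
  sameParity⇒F 2∣n b b-center same with Finₚ.any? (λ u → ¬? (u Fin.≟ b) ×-dec (0 <? p u))
  ... | yes (u , u≢b , u-center) = inj₂ ((b , u , u≢b ∘ sym , b-center , u-center) , consecutiveOdd)
    where
    consecutiveOdd : ConsecutiveOdd n p
    consecutiveOdd i zero    () _ _ _ _
    consecutiveOdd i (suc d) _  _ i-center j-center _ 2∣d =
      shift-odd 2∣n i 2∣d (trans (same _ j-center) (sym (same i i-center)))
  ... | no none = inj₁ (b , b-center , λ u u-center →
                         decidable-stable (u Fin.≟ b) λ u≢b → none (u , u≢b , u-center))

  lastCenter : ∀ b → IsCenter p b → ∀ d →
               ∃ λ e → e ≤ d × IsCenter p (shift b e) ×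
                       (∀ e′ → e < e′ → e′ ≤ d → ¬ IsCenter p (shift b e′))
  lastCenter b b-center zero =
    0 , z≤n , subst (IsCenter p) (sym (shift-zero b)) b-center , λ _ e<e′ e′≤0 _ → <⇒≱ e<e′ e′≤0
  lastCenter b b-center (suc d) with 0 <? p (shift b (suc d)) | lastCenter b b-center d
  ... | yes d-center | _ = suc d , ≤-refl , d-center , λ _ e<e′ e′≤e _ → <⇒≱ e<e′ e′≤e
  ... | no ¬d-center | e , e≤d , e-center , none = e , m≤n⇒m≤1+n e≤d , e-center , none′
    where
    none′ : ∀ e′ → e < e′ → e′ ≤ suc d → ¬ IsCenter p (shift b e′)
    none′ e′ e<e′ e′≤1+d with m≤n⇒m<n∨m≡n e′≤1+d
    ... | inj₁ e′<1+d = none e′ e<e′ (≤-pred e′<1+d)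
    ... | inj₂ refl   = ¬d-center

  gap-odd : ConsecutiveOdd n p → ∀ b {e d} → e ≤ d → suc d < n →
            IsCenter p (shift b e) → IsCenter p (shift b (suc d)) →
            (∀ e′ → e < e′ → e′ ≤ d → ¬ IsCenter p (shift b e′)) → ¬ 2 ∣ (d ∸ e)
  gap-odd odd b {e} {d} e≤d 1+d<n e-center d-center none =
    odd (shift b e) (suc (d ∸ e)) (s≤s z≤n) (≤-<-trans (s≤s (m∸n≤m d e)) 1+d<n)
        e-center (subst (IsCenter p) (sym shift-gap) d-center) nothing-between
    where
    shift-gap : shift (shift b e) (suc (d ∸ e)) ≡ shift b (suc d)
    shift-gap = trans (shift-shift b e _) (cong (shift b) (trans (+-suc e (d ∸ e)) (cong suc (m+[n∸m]≡n e≤d))))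
    nothing-between : ∀ e″ → 1 ≤ e″ → e″ < suc (d ∸ e) → ¬ IsCenter p (shift (shift b e) e″)
    nothing-between e″ 1≤e″ e″<1+d∸e center = none (e + e″) (m<m+n e 1≤e″)
      (subst (e + e″ ≤_) (m+[n∸m]≡n e≤d) (+-monoʳ-≤ e (≤-pred e″<1+d∸e)))
      (subst (IsCenter p) (shift-shift b e e″) center)

  consecutiveOdd⇒2∣offset : ConsecutiveOdd n p → ∀ b → IsCenter p b →
                            ∀ d → d < n → IsCenter p (shift b d) → 2 ∣ d
  consecutiveOdd⇒2∣offset odd b b-center = <-rec P go
    where
    P : ℕ → Set
    P d = d < n → IsCenter p (shift b d) → 2 ∣ d
    go : ∀ d → (∀ {e} → e < d → P e) → P d
    go zero    _   _     _        = 2 ∣0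
    go (suc d) rec 1+d<n d-center with lastCenter b b-center d
    ... | e , e≤d , e-center , none = ¬2∣⇒2∣1+ λ 2∣d →
          gap-odd odd b e≤d 1+d<n e-center d-center none
            (∣m+n∣m⇒∣n (subst (2 ∣_) (sym (m+[n∸m]≡n e≤d)) 2∣d)
                       (rec (s≤s e≤d) (<-trans (s≤s e≤d) 1+d<n) e-center))

  F⇒sameParity : 2 ∣ n → ∀ b → IsCenter p b →
                 InF₁ n p ⊎ (InF₂ n p × ConsecutiveOdd n p) → SameParityCenters b
  F⇒sameParity _ b b-center (inj₁ (_ , _ , unique)) u u-center =
    cong (λ z → toℕ z % 2) (trans (unique u u-center) (sym (unique b b-center)))
  F⇒sameParity 2∣n b b-center (inj₂ (_ , odd)) u u-center =
    subst (λ z → SameParity z b) (shift-offset b u) (shift-even 2∣n b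
      (consecutiveOdd⇒2∣offset odd b b-center (offset b u) (offset<n b u)
        (subst (IsCenter p) (sym (shift-offset b u)) u-center)))

module Graph (m : ℕ) (2≤m : 2 ≤ m) (p : Fin (suc m) → ℕ) (sc : Fin (suc m) → Sign)
             (sp : (i : Fin (suc m)) → Fin (p i) → Sign) where
  open import Data.Nat using (z≤n; _<?_)
  open import Data.Rational using (ℚ; 0ℚ; 1ℚ; _+_; _*_)
  import Data.Rational.Properties as ℚₚ
  open import Data.Rational.Solver using (module +-*-Solver)
  open +-*-Solver
  open ≡-Reasoning
  open Cycle m
  open Centers m p

  V : Set
  V = Vertex n p

  M : V → V → ℚ
  M = adj n p sc sp

  sgn≢0 : ∀ s → sgn s ≢ 0ℚ
  sgn≢0 plus  ()
  sgn≢0 minus ()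

  firstPendant : ∀ {u} → IsCenter p u → Fin (p u)
  firstPendant u-center = fromℕ< u-center

  pendant⇒center : ∀ {u} → Fin (p u) → IsCenter p u
  pendant⇒center j = ℕₚ.≤-<-trans z≤n (Finₚ.toℕ<n j)

  unit : Fin n → V → ℚ
  unit y (inj₁ z) = δ y z
  unit y (inj₂ _) = 0ℚ

  cycleEntry-next : ∀ x → cycleEntry sc x (next x) ≡ sgn (sc x)
  cycleEntry-next x with next x Fin.≟ next x
  ... | yes _   = refl
  ... | no  ≢refl = ⊥-elim (≢refl refl)

  cycleEntry-prev : ∀ x → cycleEntry sc x (prev x) ≡ sgn (sc (prev x))
  cycleEntry-prev x with prev x Fin.≟ next x | x Fin.≟ next (prev x)
  ... | yes prev≡next | _ = ⊥-elim (prev≢next 2≤m x prev≡next)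
  ... | no _ | yes _      = refl
  ... | no _ | no x≢      = ⊥-elim (x≢ (sym (next-prev x)))

  cycleEntry-nonadjacent : ∀ {x y} → x ≢ prev y → x ≢ next y → cycleEntry sc x y ≡ 0ℚ
  cycleEntry-nonadjacent {x} {y} x≢prev x≢next with y Fin.≟ next x | x Fin.≟ next y
  ... | yes y≡next | _ = ⊥-elim (x≢prev (trans (sym (prev-next x)) (cong prev (sym y≡next))))
  ... | no _ | yes x≡next = ⊥-elim (x≢next x≡next)
  ... | no _ | no _       = refl

  pendEntry-self : ∀ u j → pendEntry {p = p} sp u u j ≡ sgn (sp u j)
  pendEntry-self u j with u Fin.≟ u
  ... | yes _     = refl
  ... | no  ≢refl = ⊥-elim (≢refl refl)

  pendEntry-other : ∀ {x u} j → x ≢ u → pendEntry {p = p} sp x u j ≡ 0ℚ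
  pendEntry-other {x} {u} j x≢u with x Fin.≟ u
  ... | yes x≡u = ⊥-elim (x≢u x≡u)
  ... | no  _   = refl

  pendantRow : ∀ u j v → M (inj₂ (u , j)) v ≡ sgn (sp u j) * unit u v
  pendantRow u j (inj₁ y) with y Fin.≟ u
  ... | yes _ = sym (ℚₚ.*-identityʳ (sgn (sp u j)))
  ... | no  _ = sym (ℚₚ.*-zeroʳ (sgn (sp u j)))
  pendantRow u j (inj₂ _) = sym (ℚₚ.*-zeroʳ (sgn (sp u j)))

  cycleRow-noncenter : ∀ {x} → ¬ IsCenter p x → ∀ v →
    M (inj₁ x) v ≡ sgn (sc x) * unit (next x) v + sgn (sc (prev x)) * unit (prev x) v
  cycleRow-noncenter {x} _ (inj₁ y) = by-cases (y Fin.≟ next x) (y Fin.≟ prev x)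
    where
    σ = sgn (sc x)
    σ′ = sgn (sc (prev x))
    by-cases : Dec (y ≡ next x) → Dec (y ≡ prev x) → cycleEntry sc x y ≡ σ * δ (next x) y + σ′ * δ (prev x) y
    by-cases (yes refl) _ = begin
      cycleEntry sc x (next x)  ≡⟨ cycleEntry-next x ⟩
      σ                         ≡⟨ solve 2 (λ σ σ′ → σ := σ :* con 1ℚ :+ σ′ :* con 0ℚ) refl σ σ′ ⟩
      σ * 1ℚ + σ′ * 0ℚ          ≡⟨ cong₂ (λ a b → σ * a + σ′ * b) (δ-diag (next x))
                                                                      (δ-offDiag (next≢prev 2≤m x)) ⟨
      σ * δ (next x) (next x) + σ′ * δ (prev x) (next x) ∎
    by-cases (no y≢next) (yes refl) = begin
      cycleEntry sc x (prev x)  ≡⟨ cycleEntry-prev x ⟩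
      σ′                        ≡⟨ solve 2 (λ σ σ′ → σ′ := σ :* con 0ℚ :+ σ′ :* con 1ℚ) refl σ σ′ ⟩
      σ * 0ℚ + σ′ * 1ℚ          ≡⟨ cong₂ (λ a b → σ * a + σ′ * b) (δ-offDiag y≢next) (δ-diag (prev x)) ⟨
      σ * δ (next x) (prev x) + σ′ * δ (prev x) (prev x) ∎
    by-cases (no y≢next) (no y≢prev) = begin
      cycleEntry sc x y
        ≡⟨ cycleEntry-nonadjacent {x} {y}
             (λ x≡prev → y≢next (trans (sym (next-prev y)) (cong next (sym x≡prev))))
             (λ x≡next → y≢prev (trans (sym (prev-next y)) (cong prev (sym x≡next)))) ⟩
      0ℚ                 ≡⟨ solve 2 (λ σ σ′ → con 0ℚ := σ :* con 0ℚ :+ σ′ :* con 0ℚ) refl σ σ′ ⟩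
      σ * 0ℚ + σ′ * 0ℚ   ≡⟨ cong₂ (λ a b → σ * a + σ′ * b) (δ-offDiag y≢next) (δ-offDiag y≢prev) ⟨
      σ * δ (next x) y + σ′ * δ (prev x) y ∎
  cycleRow-noncenter {x} ¬center (inj₂ (u , j)) = begin
    pendEntry {p = p} sp x u j  ≡⟨ pendEntry-other {x} {u} j (λ { refl → ¬center (pendant⇒center j) }) ⟩
    0ℚ                          ≡⟨ solve 2 (λ σ σ′ → con 0ℚ := σ :* con 0ℚ :+ σ′ :* con 0ℚ)
                                           refl (sgn (sc x)) (sgn (sc (prev x))) ⟩
    sgn (sc x) * 0ℚ + sgn (sc (prev x)) * 0ℚ ∎

  cycleColumn : ∀ (d : Fin n → ℚ) y →
    sum (λ x → d x * cycleEntry sc x y) ≡ d (prev y) * sgn (sc (prev y)) + d (next y) * sgn (sc y)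
  cycleColumn d y = begin
    sum (λ x → d x * cycleEntry sc x y)
      ≡⟨ sum-pair _ (prev≢next 2≤m y) (λ x x≢prev x≢next →
           x≡0⇒a*x≡0 (d x) (cycleEntry-nonadjacent {x} {y} x≢prev x≢next)) ⟩
    d (prev y) * cycleEntry sc (prev y) y + d (next y) * cycleEntry sc (next y) y
      ≡⟨ cong₂ (λ a b → d (prev y) * a + d (next y) * b)
               (subst (λ z → cycleEntry sc (prev y) z ≡ sgn (sc (prev y))) (next-prev y) (cycleEntry-next (prev y)))
               (subst (λ z → cycleEntry sc (next y) z ≡ sgn (sc z)) (prev-next y) (cycleEntry-prev (next y))) ⟩
    d (prev y) * sgn (sc (prev y)) + d (next y) * sgn (sc y) ∎

  pendantColumn : ∀ (d : Fin n → ℚ) u j → sum (λ x → d x * pendEntry {p = p} sp x u j) ≡ d u * sgn (sp u j)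
  pendantColumn d u j = trans (sum-single _ u λ x x≢u → x≡0⇒a*x≡0 (d x) (pendEntry-other {x} {u} j x≢u))
                              (cong (d u *_) (pendEntry-self u j))

  module Overfull (b : Fin n) (b-center : IsCenter p b) (odd : OddCenter b) where

    q = proj₁ odd
    q-bound = proj₁ (proj₂ odd)
    q-center = proj₂ (proj₂ odd)

    rows : Fin (suc n) → V
    rows zero    = inj₂ (b , firstPendant b-center)
    rows (suc x) = inj₁ x

    independent : RowsIndependent M rows
    independent c kills = λ where
        zero    → c₀≡0
        (suc x) → d≡0 x
      where
      d : Fin n → ℚ
      d x = c (suc x)
      j₀ = firstPendant b-center
      Vanishes : Fin n → Set
      Vanishes x = d x ≡ 0ℚ
      column : ∀ v → c zero * M (rows zero) v + sum (λ x → d x * M (inj₁ x) v) ≡ 0ℚ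
      column v = trans (sym (∑≡sum (suc n) (λ i → c i * M (rows i) v))) (kills v)
      center-vanishes : ∀ u → IsCenter p u → Vanishes u
      center-vanishes u u-center = z+x*a≡0⇒x≡0 (sgn≢0 (sp u j)) (ℚₚ.*-zeroʳ (c zero))
          (trans (cong (c zero * 0ℚ +_) (sym (pendantColumn d u j))) (column (inj₂ (u , j))))
        where j = firstPendant u-center
      neighbours : ∀ y → y ≢ b → d (prev y) * sgn (sc (prev y)) + d (next y) * sgn (sc y) ≡ 0ℚ
      neighbours y y≢b = trans (sym (cycleColumn d y))
        (z+w≡0⇒w≡0 (x≡0⇒a*x≡0 (c zero) (pendEntry-other j₀ y≢b)) (column (inj₁ y)))
      d≡0 : ∀ x → Vanishes x
      d≡0 = cover-path Vanishes b
        (λ y y≢b d-prev → z+x*a≡0⇒x≡0 (sgn≢0 (sc y)) (x≡0⇒x*a≡0 _ d-prev) (neighbours y y≢b))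
        (λ y y≢b d-next → x*a+z≡0⇒x≡0 (sgn≢0 (sc (prev y))) (x≡0⇒x*a≡0 _ d-next) (neighbours y y≢b))
        (center-vanishes b b-center) q q-bound (center-vanishes _ q-center)
      c₀≡0 : c zero ≡ 0ℚ
      c₀≡0 = x*a+z≡0⇒x≡0 (subst (_≢ 0ℚ) (sym (pendEntry-self b j₀)) (sgn≢0 (sp b j₀)))
        (sum-zero λ x → x≡0⇒x*a≡0 (cycleEntry sc x b) (d≡0 x)) (column (inj₁ b))

  module Balanced (b : Fin n) (b-center : IsCenter p b) (2∣n : 2 ∣ n) (same : SameParityCenters b) where

    Even : Fin n → Set
    Even x = SameParity x b

    ¬Even⇒¬center : ∀ {x} → ¬ Even x → ¬ IsCenter p x
    ¬Even⇒¬center ¬Ex x-center = ¬Ex (same _ x-center)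

    Even⇒¬Even-prev : ∀ {x} → Even x → ¬ Even (prev x)
    Even⇒¬Even-prev {x} Ex Eprev = prev-flips 2∣n x (trans Eprev (sym Ex))

    ¬Even⇒¬Even-prev² : ∀ {x} → ¬ Even x → ¬ Even (prev (prev x))
    ¬Even⇒¬Even-prev² {x} ¬Ex Eprev² = ¬Ex (trans (sym (prev²-sameParity 2∣n x)) Eprev²)

    rowWith : (x : Fin n) → Dec (Even x) → Dec (IsCenter p (next x)) → V
    rowWith x (yes _) _               = inj₁ x
    rowWith x (no _)  (yes next-center) = inj₂ (next x , firstPendant next-center)
    rowWith x (no _)  (no _)          = inj₁ x

    row : Fin n → V
    row x = rowWith x (sameParity? x b) (0 <? p (next x))

    rowWith-pendant : ∀ {x u} dE dC j → x ≢ u → M (rowWith x dE dC) (inj₂ (u , j)) ≡ 0ℚ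
    rowWith-pendant (yes _) _       j x≢u = pendEntry-other j x≢u
    rowWith-pendant (no _)  (yes _) j _   = refl
    rowWith-pendant (no _)  (no _)  j x≢u = pendEntry-other j x≢u

    rowWith-center : ∀ {u} dE dC j → Even u → M (rowWith u dE dC) (inj₂ (u , j)) ≡ sgn (sp u j)
    rowWith-center (yes _)  _ j _  = pendEntry-self _ j
    rowWith-center (no ¬Eu) _ j Eu = ⊥-elim (¬Eu Eu)

    rowWith-next≢0 : ∀ {x} dE dC → M (rowWith x dE dC) (inj₁ (next x)) ≢ 0ℚ
    rowWith-next≢0 {x} (yes _) _ = subst (_≢ 0ℚ) (sym (cycleEntry-next x)) (sgn≢0 (sc x))
    rowWith-next≢0 {x} (no _) (yes next-center) =
      subst (_≢ 0ℚ) (sym (pendEntry-self (next x) _)) (sgn≢0 (sp (next x) (firstPendant next-center)))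
    rowWith-next≢0 {x} (no _) (no _) = subst (_≢ 0ℚ) (sym (cycleEntry-next x)) (sgn≢0 (sc x))

    rowWith-nonadjacent : ∀ {x y} dE dC → x ≢ prev y → x ≢ next y → M (rowWith x dE dC) (inj₁ y) ≡ 0ℚ
    rowWith-nonadjacent {x} {y} (yes _) _ x≢prev x≢next = cycleEntry-nonadjacent {x} {y} x≢prev x≢next
    rowWith-nonadjacent {x} {y} (no _) (yes _) x≢prev _ =
      pendEntry-other {y} {next x} _ (λ y≡next → x≢prev (trans (sym (prev-next x)) (cong prev (sym y≡next))))
    rowWith-nonadjacent {x} {y} (no _) (no _) x≢prev x≢next = cycleEntry-nonadjacent {x} {y} x≢prev x≢next

    rowWith-prev≡0 : ∀ {x} dE dC → ¬ Even x → IsCenter p (next x) → M (rowWith x dE dC) (inj₁ (prev x)) ≡ 0ℚ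
    rowWith-prev≡0 (yes Ex) _ ¬Ex _ = ⊥-elim (¬Ex Ex)
    rowWith-prev≡0 {x} (no _) (yes _) _ _ = pendEntry-other _ (prev≢next 2≤m x)
    rowWith-prev≡0 (no _) (no ¬center) _ center = ⊥-elim (¬center center)

    independent : RowsIndependent M row
    independent c kills = cover-descent 2∣n Vanishes b back (center-vanishes b b-center) prev³-vanishes
      where
      Vanishes : Fin n → Set
      Vanishes x = c x ≡ 0ℚ
      column : ∀ v → sum (λ x → c x * M (row x) v) ≡ 0ℚ
      column v = trans (sym (∑≡sum n (λ x → c x * M (row x) v))) (kills v)
      center-vanishes : ∀ u → IsCenter p u → Vanishes u
      center-vanishes u u-center = x*a≡0⇒x≡0 (sgn≢0 (sp u j)) (trans (sym at-pendant) (column (inj₂ (u , j))))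
        where
        j = firstPendant u-center
        at-pendant : sum (λ x → c x * M (row x) (inj₂ (u , j))) ≡ c u * sgn (sp u j)
        at-pendant = trans
          (sum-single (λ x → c x * M (row x) (inj₂ (u , j))) u λ x x≢u →
             x≡0⇒a*x≡0 (c x) (rowWith-pendant {x} {u} (sameParity? x b) _ j x≢u))
          (cong (c u *_) (rowWith-center (sameParity? u b) _ j (same u u-center)))
      neighbours : ∀ y → c (prev y) * M (row (prev y)) (inj₁ y) + c (next y) * M (row (next y)) (inj₁ y) ≡ 0ℚ
      neighbours y = trans
        (sym (sum-pair (λ x → c x * M (row x) (inj₁ y)) (prev≢next 2≤m y) λ x x≢prev x≢next →
                x≡0⇒a*x≡0 (c x) (rowWith-nonadjacent {x} {y} (sameParity? x b) _ x≢prev x≢next)))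
        (column (inj₁ y))
      prev-entry≢0 : ∀ y → M (row (prev y)) (inj₁ y) ≢ 0ℚ
      prev-entry≢0 y = subst (λ z → M (row (prev y)) (inj₁ z) ≢ 0ℚ) (next-prev y)
                             (rowWith-next≢0 {prev y} (sameParity? (prev y) b) _)
      back : ∀ y → Vanishes (next y) → Vanishes (prev y)
      back y c-next = x*a+z≡0⇒x≡0 (prev-entry≢0 y) (x≡0⇒x*a≡0 _ c-next) (neighbours y)
      -- row (prev b) is a pendant row at b, so it vanishes in the column of y₀ = prev (prev b).
      prev³-vanishes : Vanishes (prev (prev (prev b)))
      prev³-vanishes = x*a+z≡0⇒x≡0 (prev-entry≢0 y₀) (x≡0⇒a*x≡0 (c (next y₀)) entry≡0) (neighbours y₀)
        where
        y₀ = prev (prev b)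
        entry≡0 : M (row (next y₀)) (inj₁ y₀) ≡ 0ℚ
        entry≡0 = subst (λ z → M (row z) (inj₁ y₀) ≡ 0ℚ) (sym (next-prev (prev b)))
          (rowWith-prev≡0 {prev b} (sameParity? (prev b) b) _ (Even⇒¬Even-prev {b} refl)
                          (subst (IsCenter p) (sym (next-prev b)) b-center))

    spanWith : (t : Fin n) → Dec (Even t) → V → ℚ
    spanWith t (yes _) = M (inj₁ t)
    spanWith t (no _)  = unit (next t)

    spanner : Fin n → V → ℚ
    spanner t = spanWith t (sameParity? t b)

    spanWith-Even : ∀ {t} dE → Even t → spanWith t dE ≡ M (inj₁ t)
    spanWith-Even (yes _)  _  = refl
    spanWith-Even (no ¬Et) Et = ⊥-elim (¬Et Et)

    spanWith-¬Even : ∀ {t} dE → ¬ Even t → spanWith t dE ≡ unit (next t)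
    spanWith-¬Even (yes Et) ¬Et = ⊥-elim (¬Et Et)
    spanWith-¬Even (no _)   _   = refl

    coeffWith : (x : Fin n) → Dec (Even x) → Fin n → ℚ
    coeffWith x (yes _) t = δ x t
    coeffWith x (no _)  t = sgn (sc x) * δ x t + sgn (sc (prev x)) * δ (prev (prev x)) t

    coeff : V → Fin n → ℚ
    coeff (inj₁ x)       = coeffWith x (sameParity? x b)
    coeff (inj₂ (u , j)) t = sgn (sp u j) * δ (prev u) t

    cycleRow-in-span : ∀ x dE v → M (inj₁ x) v ≡ sum (λ t → coeffWith x dE t * spanner t v)
    cycleRow-in-span x (yes Ex) v =
      sym (trans (sum-δ x (λ t → spanner t v)) (cong (λ f → f v) (spanWith-Even {x} (sameParity? x b) Ex)))
    cycleRow-in-span x (no ¬Ex) v = sym (begin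
      sum (λ t → (σ * δ x t + σ′ * δ (prev (prev x)) t) * spanner t v)
        ≡⟨ sum-δ₂ σ σ′ x (prev (prev x)) (λ t → spanner t v) ⟩
      σ * spanner x v + σ′ * spanner (prev (prev x)) v
        ≡⟨ cong₂ (λ f g → σ * f v + σ′ * g v) (spanWith-¬Even {x} (sameParity? x b) ¬Ex)
                 (spanWith-¬Even {prev (prev x)} (sameParity? (prev (prev x)) b) (¬Even⇒¬Even-prev² {x} ¬Ex)) ⟩
      σ * unit (next x) v + σ′ * unit (next (prev (prev x))) v
        ≡⟨ cong (λ z → σ * unit (next x) v + σ′ * unit z v) (next-prev (prev x)) ⟩
      σ * unit (next x) v + σ′ * unit (prev x) v
        ≡⟨ cycleRow-noncenter (¬Even⇒¬center ¬Ex) v ⟨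
      M (inj₁ x) v ∎)
      where σ = sgn (sc x); σ′ = sgn (sc (prev x))

    row-in-span : ∀ v u → M v u ≡ sum (λ t → coeff v t * spanner t u)
    row-in-span (inj₁ x) = cycleRow-in-span x (sameParity? x b)
    row-in-span (inj₂ (u , j)) v = sym (begin
      sum (λ t → σ * δ (prev u) t * spanner t v)  ≡⟨ sum-scaled-δ σ (prev u) (λ t → spanner t v) ⟩
      σ * spanner (prev u) v
        ≡⟨ cong (λ f → σ * f v) (spanWith-¬Even {prev u} (sameParity? (prev u) b)
                                                (Even⇒¬Even-prev {u} (same u (pendant⇒center j)))) ⟩
      σ * unit (next (prev u)) v                  ≡⟨ cong (λ z → σ * unit z v) (next-prev u) ⟩
      σ * unit u v                                ≡⟨ pendantRow u j v ⟨
      M (inj₂ (u , j)) v                          ∎)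
      where σ = sgn (sp u j)

    hasRank : HasRank M n
    hasRank = (row , independent) , span⇒¬independent M spanner coeff row-in-span

lemma3p7 : (g : ℕ) → 3 ≤ g → (p : Fin g → ℕ) → Σ (Fin g) (IsCenter p) →
    (sc : Fin g → Sign) → (sp : (i : Fin g) → Fin (p i) → Sign) →
    HasRank (adj g p sc sp) g ⇔ ((2 ∣ g) × (InF₁ g p ⊎ (InF₂ g p × ConsecutiveOdd g p)))
lemma3p7 (suc m) (s≤s 2≤m) p (b , b-center) sc sp = mk⇔ rank⇒structure structure⇒rank
  where
  open Cycle m
  open Centers m p
  open Graph m 2≤m p sc sp
  overfull : OddCenter b → ¬ HasRank M n
  overfull odd (_ , ¬independent) = ¬independent (Overfull.rows b b-center odd) (Overfull.independent b b-center odd)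
  rank⇒structure : HasRank M n → (2 ∣ n) × (InF₁ n p ⊎ (InF₂ n p × ConsecutiveOdd n p))
  rank⇒structure rank with 2 ∣? n
  ... | no ¬2∣n = ⊥-elim (overfull (oddCenter-if-n-odd ¬2∣n b b-center) rank)
  ... | yes 2∣n with sameParity-or-witness b
  ...   | inj₁ same = 2∣n , sameParity⇒F 2∣n b b-center same
  ...   | inj₂ (w , w-center , w≁b) = ⊥-elim (overfull (oddCenter-if-parity-differs 2∣n b w-center w≁b) rank)
  structure⇒rank : (2 ∣ n) × (InF₁ n p ⊎ (InF₂ n p × ConsecutiveOdd n p)) → HasRank M n
  structure⇒rank (2∣n , structure) = Balanced.hasRank b b-center 2∣n (F⇒sameParity 2∣n b b-center structure)
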